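{- Let $G=(V,E)$ be a connected graph and let $C\subseteq V$. Then $C$ is a connected vertex cover of $G$ if and only if there exists $y\in[0,1]^E$ such that, with $x=\chi^C\in\{0,1\}^V$, the following hold: (i) $x_u+x_v\geq 1$ for every edge $uv\in E$; (ii) $y(E(U))\leq |U|-1$ for every nonempty $U\subseteq V$; (iii) $y(E)=x(V)-1$; (iv) $y_{uv}\leq x_u$ and $y_{uv}\leq x_v$ for every edge $uv\in E$.
   Context: A set $C\subseteq V$ is a vertex cover of $G$ if every edge of $G$ has at least one endpoint in $C$; it is a connected vertex cover if moreover the induced subgraph $G[C]$ is connected. For a finite set $A$ and $U\subseteq A$, $\chi^U\in\{0,1\}^A$ is the incidence vector of $U$ ($\chi^U_a=1$ iff $a\in U$). For a vector $x\in\mathbb R^A$ and $U\subseteq A$, $x(U)=\sum_{u\in U}x_u$. For $U\subseteq V$, $E(U)$ denotes the set of edges of $G$ with both endpoints in $U$.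
   Formalization: The vector y takes values in the rationals in [0,1] rather than in the reals. -}

module Defs where

open import Data.Nat using (ℕ; zero; suc)
open import Data.Fin using (Fin; zero; suc)
open import Data.Fin.Subset using (Subset; _∈_; ⊤; ∣_∣; Nonempty)
open import Data.Vec using (lookup)
open import Data.Bool using (Bool; true; false; _∧_; if_then_else_)
open import Data.Integer using (+_)
open import Data.Rational using (ℚ; 0ℚ; 1ℚ; _+_; _-_; _≤_; _/_)
open import Data.Product using (_×_; Σ; ∃; _,_; proj₁; proj₂)
open import Data.Sum using (_⊎_)
open import Relation.Binary.PropositionalEquality using (_≡_; _≢_)

record Graph : Set where
  field
    n    : ℕ
    m    : ℕ
    end₁ : Fin m → Fin n
    end₂ : Fin m → Fin n
    loopless : ∀ e → end₁ e ≢ end₂ e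
    simple   : ∀ e f → (end₁ e ≡ end₁ f × end₂ e ≡ end₂ f)
                       ⊎ (end₁ e ≡ end₂ f × end₂ e ≡ end₁ f) → e ≡ f
open Graph public

Adj : (G : Graph) → Fin (n G) → Fin (n G) → Set
Adj G u v = ∃ λ e → (end₁ G e ≡ u × end₂ G e ≡ v) ⊎ (end₁ G e ≡ v × end₂ G e ≡ u)

data Reach (G : Graph) (S : Subset (n G)) (u : Fin (n G)) : Fin (n G) → Set where
  here : u ∈ S → Reach G S u u
  step : ∀ {w v} → Reach G S u w → Adj G w v → v ∈ S → Reach G S u v

InducedConnected : (G : Graph) → Subset (n G) → Set
InducedConnected G S = Nonempty S × (∀ u v → u ∈ S → v ∈ S → Reach G S u v)

Connected : Graph → Set
Connected G = InducedConnected G ⊤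

IsVertexCover : (G : Graph) → Subset (n G) → Set
IsVertexCover G C = ∀ e → end₁ G e ∈ C ⊎ end₂ G e ∈ C

IsConnectedVertexCover : (G : Graph) → Subset (n G) → Set
IsConnectedVertexCover G C = IsVertexCover G C × InducedConnected G C

∑ : ∀ k → (Fin k → ℚ) → ℚ
∑ zero    f = 0ℚ
∑ (suc k) f = f zero + ∑ k (λ i → f (suc i))

ℕ→ℚ : ℕ → ℚ
ℕ→ℚ k = + k / 1

χ : ∀ {k} → Subset k → Fin k → ℚ
χ C u = if lookup C u then 1ℚ else 0ℚ

xSum : (G : Graph) → (Fin (n G) → ℚ) → ℚ
xSum G x = ∑ (n G) x

ySum : (G : Graph) → (Fin (m G) → ℚ) → ℚ
ySum G y = ∑ (m G) y

yInside : (G : Graph) → Subset (n G) → (Fin (m G) → ℚ) → ℚ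
yInside G U y = ∑ (m G) (λ e → if lookup U (end₁ G e) ∧ lookup U (end₂ G e) then y e else 0ℚ)

module Submission where

-- Forward: grow a spanning tree of G[C] from one vertex, each step adding an edge from the
-- current vertex set T to a new vertex b ∈ C ─ T. The new edge is the only tree edge at b, so
-- by induction every vertex set U spans at most |U| - 1 tree edges, and the incidence vector of
-- the final tree (|C| - 1 edges) is the required y.
-- Backward: condition (i) is the vertex-cover property. Grow the same way a set T ∋ u inside C
-- that no edge of G[C] leaves. If some v ∈ C lay outside T, every edge of positive weight would
-- lie in E(T) or E(C ─ T), and (ii) for these two sets would give y(E) ≤ |C| - 2, against (iii).

open import Defs
open import Data.Bool using (true; false; _∧_; if_then_else_)
import Data.Integer as ℤ
import Data.Integer.Properties as ℤ
open import Data.Fin using (Fin; zero; suc)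
open import Data.Fin.Properties using (any?)
open import Data.Fin.Subset
  using (Subset; _∈_; _∉_; _⊆_; _⊂_; _⊃_; _∩_; _∪_; _─_; ⁅_⁆; ∣_∣; Nonempty; Empty; inside; outside)
  renaming (⊥ to ∅)
open import Data.Fin.Subset.Properties
  using ( _∈?_; ⊆-antisym; p⊆q⇒∣p∣≤∣q∣; ∣⊥∣≡0; ⊥⊆; Empty-unique; nonempty?
        ; x∈⁅x⁆; x∈⁅y⁆⇒x≡y; ∣⁅x⁆∣≡1; ∪-identityˡ; q⊆p∪q; x∈p∪q⁺; x∈p∪q⁻
        ; x∈p∩q⁺; x∈p∩q⁻; p∩q⊆q; ∣p∩q∣≤∣q∣; x∈p∧x≢y⇒x∈p-y; x∈p⇒∣p-x∣<∣p∣; x∈p∧x∉q⇒x∈p─q)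
open import Data.Fin.Subset.Induction using (Acc; acc; ⊃-wellFounded)
open import Data.Nat as ℕ using (ℕ; zero; suc; s≤s; z≤n)
import Data.Nat.Properties as ℕ
open import Data.Nat.Coprimality using (1-coprimeTo)
import Data.Nat.Coprimality as Coprime
open import Data.Product using (_×_; Σ; ∃; _,_; proj₁; proj₂)
open import Data.Rational using (ℚ; 0ℚ; 1ℚ; _+_; _-_; -_; _≤_; _<_; mkℚ; _/_; *≤*; *<*)
open import Data.Rational.Properties
  using ( normalize-coprime; ≤-refl; ≤-reflexive; ≤-trans; <-irrefl; ≤-<-trans
        ; +-mono-≤; +-monoˡ-≤; +-monoʳ-<; +-identityˡ; +-identityʳ; module ≤-Reasoning)
open import Data.Rational.Solver using (module +-*-Solver)
open import Data.Sum using (_⊎_; inj₁; inj₂; map₁)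
open import Data.Vec using (_∷_; []; lookup; tabulate; here; there)
open import Data.Vec.Properties using ([]=⇒lookup; lookup⇒[]=; lookup-zipWith; lookup∘tabulate)
open import Function using (_∘_)
open import Function.Bundles using (_⇔_; mk⇔; Equivalence)
open import Relation.Binary.PropositionalEquality
open import Relation.Nullary using (Dec; yes; no; contradiction)
open import Relation.Nullary.Decidable using (_×-dec_; _⊎-dec_; ¬?)

∣⁅x⁆∪p∣≡1+∣p∣ : ∀ {k} {x : Fin k} {p : Subset k} → x ∉ p → ∣ ⁅ x ⁆ ∪ p ∣ ≡ suc ∣ p ∣
∣⁅x⁆∪p∣≡1+∣p∣ {x = zero}  {outside ∷ p} _   = cong (suc ∘ ∣_∣) (∪-identityˡ p)
∣⁅x⁆∪p∣≡1+∣p∣ {x = zero}  {inside  ∷ p} x∉p = contradiction here x∉p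
∣⁅x⁆∪p∣≡1+∣p∣ {x = suc x} {outside ∷ p} x∉p = ∣⁅x⁆∪p∣≡1+∣p∣ (x∉p ∘ there)
∣⁅x⁆∪p∣≡1+∣p∣ {x = suc x} {inside  ∷ p} x∉p = cong suc (∣⁅x⁆∪p∣≡1+∣p∣ (x∉p ∘ there))

∣p∩q∣+∣p─q∣≡∣p∣ : ∀ {k} (p q : Subset k) → ∣ p ∩ q ∣ ℕ.+ ∣ p ─ q ∣ ≡ ∣ p ∣
∣p∩q∣+∣p─q∣≡∣p∣ []            []            = refl
∣p∩q∣+∣p─q∣≡∣p∣ (outside ∷ p) (inside  ∷ q) = ∣p∩q∣+∣p─q∣≡∣p∣ p q
∣p∩q∣+∣p─q∣≡∣p∣ (outside ∷ p) (outside ∷ q) = ∣p∩q∣+∣p─q∣≡∣p∣ p q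
∣p∩q∣+∣p─q∣≡∣p∣ (inside  ∷ p) (inside  ∷ q) = cong suc (∣p∩q∣+∣p─q∣≡∣p∣ p q)
∣p∩q∣+∣p─q∣≡∣p∣ (inside  ∷ p) (outside ∷ q) =
  trans (ℕ.+-suc ∣ p ∩ q ∣ ∣ p ─ q ∣) (cong suc (∣p∩q∣+∣p─q∣≡∣p∣ p q))

x∈⁅y⁆∪p⁻ : ∀ {k} {x y : Fin k} {p : Subset k} → x ∈ ⁅ y ⁆ ∪ p → x ≡ y ⊎ x ∈ p
x∈⁅y⁆∪p⁻ {y = y} {p} x∈⁅y⁆∪p = map₁ (x∈⁅y⁆⇒x≡y y) (x∈p∪q⁻ ⁅ y ⁆ p x∈⁅y⁆∪p)

p⊆q⇒∣p∣+∣q─p∣≡∣q∣ : ∀ {k} {p q : Subset k} → p ⊆ q → ∣ p ∣ ℕ.+ ∣ q ─ p ∣ ≡ ∣ q ∣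
p⊆q⇒∣p∣+∣q─p∣≡∣q∣ {p = p} {q} p⊆q = subst (λ r → ∣ r ∣ ℕ.+ ∣ q ─ p ∣ ≡ ∣ q ∣)
  (⊆-antisym (p∩q⊆q q p) (λ x∈p → x∈p∩q⁺ (p⊆q x∈p , x∈p))) (∣p∩q∣+∣p─q∣≡∣p∣ q p)

x∈p⇒1≤∣p∣ : ∀ {k} {x : Fin k} {p : Subset k} → x ∈ p → 1 ℕ.≤ ∣ p ∣
x∈p⇒1≤∣p∣ {x = x} x∈p =
  subst (ℕ._≤ _) (∣⁅x⁆∣≡1 x) (p⊆q⇒∣p∣≤∣q∣ (λ y∈⁅x⁆ → subst (_∈ _) (sym (x∈⁅y⁆⇒x≡y x y∈⁅x⁆)) x∈p))

Empty⇒∣p∣≡0 : ∀ {k} {p : Subset k} → Empty p → ∣ p ∣ ≡ 0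
Empty⇒∣p∣≡0 {k} empty = trans (cong ∣_∣ (Empty-unique empty)) (∣⊥∣≡0 k)

ℕ→ℚ≡mkℚ : ∀ k → ℕ→ℚ k ≡ mkℚ (ℤ.+ k) 0 (Coprime.sym (1-coprimeTo k))
ℕ→ℚ≡mkℚ k = normalize-coprime (Coprime.sym (1-coprimeTo k))

ℕ→ℚ-+ : ∀ a b → ℕ→ℚ (a ℕ.+ b) ≡ ℕ→ℚ a + ℕ→ℚ b
ℕ→ℚ-+ a b rewrite ℕ→ℚ≡mkℚ a | ℕ→ℚ≡mkℚ b =
  cong (_/ 1) (sym (cong₂ ℤ._+_ (ℤ.*-identityʳ (ℤ.+ a)) (ℤ.*-identityʳ (ℤ.+ b))))

ℕ→ℚ-mono-≤ : ∀ {a b} → a ℕ.≤ b → ℕ→ℚ a ≤ ℕ→ℚ b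
ℕ→ℚ-mono-≤ {a} {b} a≤b rewrite ℕ→ℚ≡mkℚ a | ℕ→ℚ≡mkℚ b =
  *≤* (ℤ.*-monoʳ-≤-nonNeg (ℤ.+ 1) (ℤ.+≤+ a≤b))

p≤q⇒p≤q+r : ∀ {p q r} → p ≤ q → 0ℚ ≤ r → p ≤ q + r
p≤q⇒p≤q+r {p} {q} {r} p≤q 0≤r = subst (_≤ q + r) (+-identityʳ p) (+-mono-≤ p≤q 0≤r)

p≤r⇒p≤q+r : ∀ {p q r} → 0ℚ ≤ q → p ≤ r → p ≤ q + r
p≤r⇒p≤q+r {p} {q} {r} 0≤q p≤r = subst (_≤ q + r) (+-identityˡ p) (+-mono-≤ 0≤q p≤r)

p-1<p : ∀ p → p - 1ℚ < p
p-1<p p = subst (p - 1ℚ <_) (+-identityʳ p) (+-monoʳ-< p (*<* ℤ.-<+))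

ℕ→ℚ-suc-1 : ∀ k → ℕ→ℚ (suc k) - 1ℚ ≡ ℕ→ℚ k
ℕ→ℚ-suc-1 k = begin
  ℕ→ℚ (suc k) - 1ℚ   ≡⟨ cong (_- 1ℚ) (trans (cong ℕ→ℚ (ℕ.+-comm 1 k)) (ℕ→ℚ-+ k 1)) ⟩
  ℕ→ℚ k + 1ℚ - 1ℚ    ≡⟨ solve 1 (λ x → x :+ con 1ℚ :- con 1ℚ := x) refl (ℕ→ℚ k) ⟩
  ℕ→ℚ k              ∎
  where open ≡-Reasoning
        open +-*-Solver

ℕ→ℚ-≤-1 : ∀ {a b} → suc a ℕ.≤ b → ℕ→ℚ a ≤ ℕ→ℚ b - 1ℚ
ℕ→ℚ-≤-1 {a} a<b = subst (_≤ _) (ℕ→ℚ-suc-1 a) (+-monoˡ-≤ (- 1ℚ) (ℕ→ℚ-mono-≤ a<b))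

ℕ→ℚ-1-strictly-superadditive : ∀ {a b c} → a ℕ.+ b ℕ.≤ c →
  (ℕ→ℚ a - 1ℚ) + (ℕ→ℚ b - 1ℚ) < ℕ→ℚ c - 1ℚ
ℕ→ℚ-1-strictly-superadditive {a} {b} {c} a+b≤c = begin-strict
  (ℕ→ℚ a - 1ℚ) + (ℕ→ℚ b - 1ℚ)
    ≡⟨ solve 2 (λ x y → (x :- con 1ℚ) :+ (y :- con 1ℚ) := x :+ y :- con 1ℚ :- con 1ℚ)
             refl (ℕ→ℚ a) (ℕ→ℚ b) ⟩
  ℕ→ℚ a + ℕ→ℚ b - 1ℚ - 1ℚ   ≡⟨ cong (λ s → s - 1ℚ - 1ℚ) (ℕ→ℚ-+ a b) ⟨
  ℕ→ℚ (a ℕ.+ b) - 1ℚ - 1ℚ   ≤⟨ +-monoˡ-≤ (- 1ℚ) (+-monoˡ-≤ (- 1ℚ) (ℕ→ℚ-mono-≤ a+b≤c)) ⟩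
  ℕ→ℚ c - 1ℚ - 1ℚ           <⟨ p-1<p (ℕ→ℚ c - 1ℚ) ⟩
  ℕ→ℚ c - 1ℚ                ∎
  where open ≤-Reasoning
        open +-*-Solver

module _ {k : ℕ} {p : Subset k} {x : Fin k} where

  χ-∈ : x ∈ p → χ p x ≡ 1ℚ
  χ-∈ x∈p rewrite []=⇒lookup x∈p = refl

  χ-∉ : x ∉ p → χ p x ≡ 0ℚ
  χ-∉ x∉p with lookup p x in eq
  ... | true  = contradiction (lookup⇒[]= x p eq) x∉p
  ... | false = refl

  χ-bounds : 0ℚ ≤ χ p x × χ p x ≤ 1ℚ
  χ-bounds with lookup p x
  ... | true  = *≤* (ℤ.+≤+ z≤n) , ≤-refl
  ... | false = ≤-refl , *≤* (ℤ.+≤+ z≤n)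

χ-mono : ∀ {k l} {p : Subset k} {q : Subset l} {x y} → (x ∈ p → y ∈ q) → χ p x ≤ χ q y
χ-mono {p = p} {q} {x} {y} x∈p⇒y∈q with x ∈? p
... | yes x∈p = ≤-reflexive (trans (χ-∈ x∈p) (sym (χ-∈ (x∈p⇒y∈q x∈p))))
... | no  x∉p = subst (_≤ χ q y) (sym (χ-∉ x∉p)) (proj₁ (χ-bounds {p = q}))

1≤χ+χ⇔ : ∀ {k} (p : Subset k) x y → 1ℚ ≤ χ p x + χ p y ⇔ (x ∈ p ⊎ y ∈ p)
1≤χ+χ⇔ p x y = mk⇔ to from
  where
  to : 1ℚ ≤ χ p x + χ p y → x ∈ p ⊎ y ∈ p
  to 1≤χ+χ with x ∈? p | y ∈? p
  ... | yes x∈p | _       = inj₁ x∈p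
  ... | no  _   | yes y∈p = inj₂ y∈p
  ... | no  x∉p | no  y∉p with *≤* (ℤ.+≤+ ()) ← subst (1ℚ ≤_) (cong₂ _+_ (χ-∉ x∉p) (χ-∉ y∉p)) 1≤χ+χ
  from : x ∈ p ⊎ y ∈ p → 1ℚ ≤ χ p x + χ p y
  from (inj₁ x∈p) = p≤q⇒p≤q+r (≤-reflexive (sym (χ-∈ x∈p))) (proj₁ (χ-bounds {p = p}))
  from (inj₂ y∈p) = p≤r⇒p≤q+r (proj₁ (χ-bounds {p = p})) (≤-reflexive (sym (χ-∈ y∈p)))

∑-cong : ∀ k {f g : Fin k → ℚ} → (∀ i → f i ≡ g i) → ∑ k f ≡ ∑ k g
∑-cong zero    f≗g = refl
∑-cong (suc k) f≗g = cong₂ _+_ (f≗g zero) (∑-cong k (f≗g ∘ suc))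

∑-mono-≤ : ∀ k {f g : Fin k → ℚ} → (∀ i → f i ≤ g i) → ∑ k f ≤ ∑ k g
∑-mono-≤ zero    f≤g = ≤-refl
∑-mono-≤ (suc k) f≤g = +-mono-≤ (f≤g zero) (∑-mono-≤ k (f≤g ∘ suc))

∑-+ : ∀ k (f g : Fin k → ℚ) → ∑ k (λ i → f i + g i) ≡ ∑ k f + ∑ k g
∑-+ zero    f g = sym (+-identityʳ 0ℚ)
∑-+ (suc k) f g = begin
  (f zero + g zero) + ∑ k (λ i → f (suc i) + g (suc i))
    ≡⟨ cong ((f zero + g zero) +_) (∑-+ k (f ∘ suc) (g ∘ suc)) ⟩
  (f zero + g zero) + (∑ k (f ∘ suc) + ∑ k (g ∘ suc))
    ≡⟨ solve 4 (λ a b c d → (a :+ b) :+ (c :+ d) := (a :+ c) :+ (b :+ d))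
             refl (f zero) (g zero) (∑ k (f ∘ suc)) (∑ k (g ∘ suc)) ⟩
  (f zero + ∑ k (f ∘ suc)) + (g zero + ∑ k (g ∘ suc))  ∎
  where open ≡-Reasoning
        open +-*-Solver

∑-nonneg : ∀ k {f : Fin k → ℚ} → (∀ i → 0ℚ ≤ f i) → 0ℚ ≤ ∑ k f
∑-nonneg zero    0≤f = ≤-refl
∑-nonneg (suc k) 0≤f = +-mono-≤ (0≤f zero) (∑-nonneg k (0≤f ∘ suc))

∑-χ : ∀ {k} (S : Subset k) → ∑ k (χ S) ≡ ℕ→ℚ ∣ S ∣
∑-χ []            = refl
∑-χ (inside  ∷ S) = trans (cong (1ℚ +_) (∑-χ S)) (sym (ℕ→ℚ-+ 1 ∣ S ∣))
∑-χ (outside ∷ S) = trans (+-identityˡ _) (∑-χ S)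

restrict : ∀ {k} → Subset k → (Fin k → ℚ) → Fin k → ℚ
restrict S f i = if lookup S i then f i else 0ℚ

module _ {k : ℕ} (S : Subset k) {i : Fin k} where

  restrict-∈ : ∀ f → i ∈ S → restrict S f i ≡ f i
  restrict-∈ f i∈S rewrite []=⇒lookup i∈S = refl

  restrict-nonneg : ∀ f → 0ℚ ≤ f i → 0ℚ ≤ restrict S f i
  restrict-nonneg f 0≤fi with lookup S i
  ... | true  = 0≤fi
  ... | false = ≤-refl

  restrict-χ : ∀ F → restrict S (χ F) i ≡ χ (S ∩ F) i
  restrict-χ F rewrite lookup-zipWith _∧_ i S F with lookup S i
  ... | true  = refl
  ... | false = refl

module _ (G : Graph) where

  Joins : Fin (m G) → Fin (n G) → Fin (n G) → Set
  Joins e a b = (end₁ G e ≡ a × end₂ G e ≡ b) ⊎ (end₁ G e ≡ b × end₂ G e ≡ a)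

  E[_] : Subset (n G) → Subset (m G)
  E[ U ] = tabulate λ e → lookup U (end₁ G e) ∧ lookup U (end₂ G e)

  module _ {U : Subset (n G)} {e : Fin (m G)} where

    ∈E[]⁺ : end₁ G e ∈ U → end₂ G e ∈ U → e ∈ E[ U ]
    ∈E[]⁺ e₁∈U e₂∈U = lookup⇒[]= e E[ U ]
      (trans (lookup∘tabulate _ e) (cong₂ _∧_ ([]=⇒lookup e₁∈U) ([]=⇒lookup e₂∈U)))

    ∈E[]⁻ : e ∈ E[ U ] → end₁ G e ∈ U × end₂ G e ∈ U
    ∈E[]⁻ e∈E with lookup U (end₁ G e) in eq₁ | lookup U (end₂ G e) in eq₂
                 | trans (sym (lookup∘tabulate _ e)) ([]=⇒lookup e∈E)
    ... | true  | true  | _  = lookup⇒[]= _ U eq₁ , lookup⇒[]= _ U eq₂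
    ... | true  | false | ()
    ... | false | _     | ()

    module _ {a b : Fin (n G)} where

      joins-∈E[]⁺ : Joins e a b → a ∈ U → b ∈ U → e ∈ E[ U ]
      joins-∈E[]⁺ (inj₁ (refl , refl)) a∈U b∈U = ∈E[]⁺ a∈U b∈U
      joins-∈E[]⁺ (inj₂ (refl , refl)) a∈U b∈U = ∈E[]⁺ b∈U a∈U

      joins-∈E[]⁻ : Joins e a b → e ∈ E[ U ] → a ∈ U × b ∈ U
      joins-∈E[]⁻ (inj₁ (refl , refl)) e∈E = ∈E[]⁻ e∈E
      joins-∈E[]⁻ (inj₂ (refl , refl)) e∈E = let e₁∈U , e₂∈U = ∈E[]⁻ e∈E in e₂∈U , e₁∈U

  E[]-mono : ∀ {U U′} → U ⊆ U′ → E[ U ] ⊆ E[ U′ ]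
  E[]-mono U⊆U′ e∈E = let e₁∈U , e₂∈U = ∈E[]⁻ e∈E in ∈E[]⁺ (U⊆U′ e₁∈U) (U⊆U′ e₂∈U)

  yInside≡∑restrict : ∀ U y → yInside G U y ≡ ∑ (m G) (restrict E[ U ] y)
  yInside≡∑restrict U y = ∑-cong (m G) λ e →
    cong (λ b → if b then y e else 0ℚ) (sym (lookup∘tabulate _ e))

  yInside-χ : ∀ U F → yInside G U (χ F) ≡ ℕ→ℚ ∣ E[ U ] ∩ F ∣
  yInside-χ U F = trans (yInside≡∑restrict U (χ F))
                        (trans (∑-cong (m G) (λ _ → restrict-χ E[ U ] F)) (∑-χ (E[ U ] ∩ F)))

  module _ (C : Subset (n G)) where

    Closed : Subset (n G) → Set
    Closed T = ∀ {a b} → Adj G a b → a ∈ T → b ∈ C → b ∈ T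

    record Exit (T : Subset (n G)) : Set where
      field
        {inner outer} : Fin (n G)
        edge   : Fin (m G)
        joins  : Joins edge inner outer
        inner∈ : inner ∈ T
        outer∈ : outer ∈ C
        outer∉ : outer ∉ T

    private
      leaves? : ∀ T a b → Dec (a ∈ T × b ∈ C × b ∉ T)
      leaves? T a b = a ∈? T ×-dec b ∈? C ×-dec ¬? (b ∈? T)

    exit-or-closed : ∀ T → Exit T ⊎ Closed T
    exit-or-closed T
      with any? (λ e → leaves? T (end₁ G e) (end₂ G e) ⊎-dec leaves? T (end₂ G e) (end₁ G e))
    ... | yes (e , inj₁ (a∈T , b∈C , b∉T)) = inj₁ record
      { edge = e ; joins = inj₁ (refl , refl) ; inner∈ = a∈T ; outer∈ = b∈C ; outer∉ = b∉T }
    ... | yes (e , inj₂ (a∈T , b∈C , b∉T)) = inj₁ record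
      { edge = e ; joins = inj₂ (refl , refl) ; inner∈ = a∈T ; outer∈ = b∈C ; outer∉ = b∉T }
    ... | no ¬exit = inj₂ closed
      where
      closed : Closed T
      closed {a} {b} (e , joins) a∈T b∈C with b ∈? T | joins
      ... | yes b∈T | _                  = b∈T
      ... | no  b∉T | inj₁ (refl , refl) = contradiction (e , inj₁ (a∈T , b∈C , b∉T)) ¬exit
      ... | no  b∉T | inj₂ (refl , refl) = contradiction (e , inj₂ (a∈T , b∈C , b∉T)) ¬exit

    reach-closed : ∀ {T u v} → Closed T → u ∈ T → Reach G C u v → v ∈ T
    reach-closed closed u∈T (here _)          = u∈T
    reach-closed closed u∈T (step r adj v∈C) = closed adj (reach-closed closed u∈T r) v∈C

    module _ (u : Fin (n G)) where

      record Tree (T : Subset (n G)) : Set where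
        field
          edges     : Subset (m G)
          root∈     : u ∈ T
          ⊆C        : T ⊆ C
          reach     : ∀ {v} → v ∈ T → Reach G C u v
          edges⊆E[] : edges ⊆ E[ T ]
          size      : ∣ T ∣ ≡ suc ∣ edges ∣
          acyclic   : ∀ U → Nonempty U → suc ∣ E[ U ] ∩ edges ∣ ℕ.≤ ∣ U ∣

      singleton : u ∈ C → Tree ⁅ u ⁆
      singleton u∈C = record
        { edges     = ∅
        ; root∈     = x∈⁅x⁆ u
        ; ⊆C        = λ v∈⁅u⁆ → subst (_∈ C) (sym (x∈⁅y⁆⇒x≡y u v∈⁅u⁆)) u∈C
        ; reach     = λ v∈⁅u⁆ → subst (Reach G C u) (sym (x∈⁅y⁆⇒x≡y u v∈⁅u⁆)) (here u∈C)
        ; edges⊆E[] = ⊥⊆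
        ; size      = trans (∣⁅x⁆∣≡1 u) (cong suc (sym (∣⊥∣≡0 (m G))))
        ; acyclic   = λ U (_ , x∈U) → ℕ.≤-trans
            (s≤s (ℕ.≤-trans (∣p∩q∣≤∣q∣ E[ U ] ∅) (ℕ.≤-reflexive (∣⊥∣≡0 (m G)))))
            (x∈p⇒1≤∣p∣ x∈U)
        }

      module Extend {T} (t : Tree T) (x : Exit T) where
        open Tree t
        open Exit x renaming (inner to a; outer to b; edge to e)

        T′ : Subset (n G)
        T′ = ⁅ b ⁆ ∪ T

        edges′ : Subset (m G)
        edges′ = ⁅ e ⁆ ∪ edges

        T⊂T′ : T ⊂ T′
        T⊂T′ = q⊆p∪q ⁅ b ⁆ T , b , x∈p∪q⁺ (inj₁ (x∈⁅x⁆ b)) , outer∉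

        b∈T′ : b ∈ T′
        b∈T′ = x∈p∪q⁺ (inj₁ (x∈⁅x⁆ b))

        ∈T⇒≢b : ∀ {v} → v ∈ T → v ≢ b
        ∈T⇒≢b v∈T refl = outer∉ v∈T

        e∉edges : e ∉ edges
        e∉edges e∈edges = outer∉ (proj₂ (joins-∈E[]⁻ joins (edges⊆E[] e∈edges)))

        ⊆C′ : T′ ⊆ C
        ⊆C′ v∈T′ with x∈⁅y⁆∪p⁻ v∈T′
        ... | inj₁ refl = outer∈
        ... | inj₂ v∈T  = ⊆C v∈T

        reach′ : ∀ {v} → v ∈ T′ → Reach G C u v
        reach′ v∈T′ with x∈⁅y⁆∪p⁻ v∈T′
        ... | inj₁ refl = step (reach inner∈) (e , joins) outer∈
        ... | inj₂ v∈T  = reach v∈T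

        edges′⊆E[T′] : edges′ ⊆ E[ T′ ]
        edges′⊆E[T′] f∈edges′ with x∈⁅y⁆∪p⁻ f∈edges′
        ... | inj₁ refl     = joins-∈E[]⁺ joins (x∈p∪q⁺ (inj₂ inner∈)) b∈T′
        ... | inj₂ f∈edges  = E[]-mono (q⊆p∪q ⁅ b ⁆ T) (edges⊆E[] f∈edges)

        size′ : ∣ T′ ∣ ≡ suc ∣ edges′ ∣
        size′ = begin
          ∣ T′ ∣                ≡⟨ ∣⁅x⁆∪p∣≡1+∣p∣ outer∉ ⟩
          suc ∣ T ∣             ≡⟨ cong suc size ⟩
          suc (suc ∣ edges ∣)   ≡⟨ cong suc (∣⁅x⁆∪p∣≡1+∣p∣ e∉edges) ⟨
          suc ∣ edges′ ∣        ∎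
          where open ≡-Reasoning

        -- Old tree edges avoid b, so e is the only tree edge counted in U but not in U ─ ⁅ b ⁆.
        acyclic′ : ∀ U → Nonempty U → suc ∣ E[ U ] ∩ edges′ ∣ ℕ.≤ ∣ U ∣
        acyclic′ U ne with e ∈? E[ U ]
        ... | no  e∉E[U] = ℕ.≤-trans (s≤s (p⊆q⇒∣p∣≤∣q∣ old)) (acyclic U ne)
          where
          old : E[ U ] ∩ edges′ ⊆ E[ U ] ∩ edges
          old f∈ with x∈p∩q⁻ E[ U ] edges′ f∈
          ... | f∈E[U] , f∈edges′ with x∈⁅y⁆∪p⁻ f∈edges′
          ...   | inj₁ refl    = contradiction f∈E[U] e∉E[U]
          ...   | inj₂ f∈edges = x∈p∩q⁺ (f∈E[U] , f∈edges)
        ... | yes e∈E[U] = begin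
          suc ∣ E[ U ] ∩ edges′ ∣            ≤⟨ s≤s (p⊆q⇒∣p∣≤∣q∣ split) ⟩
          suc ∣ ⁅ e ⁆ ∪ (E[ U⁻ ] ∩ edges) ∣   ≡⟨ cong suc (∣⁅x⁆∪p∣≡1+∣p∣ e∉E[U⁻]∩edges) ⟩
          suc (suc ∣ E[ U⁻ ] ∩ edges ∣)      ≤⟨ s≤s (acyclic U⁻ (a , a∈U⁻)) ⟩
          suc ∣ U⁻ ∣                         ≤⟨ x∈p⇒∣p-x∣<∣p∣ b∈U ⟩
          ∣ U ∣                              ∎
          where
          open ℕ.≤-Reasoning
          a∈U : a ∈ U
          a∈U = proj₁ (joins-∈E[]⁻ joins e∈E[U])
          b∈U : b ∈ U
          b∈U = proj₂ (joins-∈E[]⁻ joins e∈E[U])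
          U⁻ : Subset (n G)
          U⁻ = U ─ ⁅ b ⁆
          a∈U⁻ : a ∈ U⁻
          a∈U⁻ = x∈p∧x≢y⇒x∈p-y a∈U (∈T⇒≢b inner∈)
          e∉E[U⁻]∩edges : e ∉ E[ U⁻ ] ∩ edges
          e∉E[U⁻]∩edges = e∉edges ∘ proj₂ ∘ x∈p∩q⁻ _ _
          split : E[ U ] ∩ edges′ ⊆ ⁅ e ⁆ ∪ (E[ U⁻ ] ∩ edges)
          split f∈ with x∈p∩q⁻ E[ U ] edges′ f∈
          ... | f∈E[U] , f∈edges′ with x∈⁅y⁆∪p⁻ f∈edges′
          ...   | inj₁ refl    = x∈p∪q⁺ (inj₁ (x∈⁅x⁆ e))
          ...   | inj₂ f∈edges =
            x∈p∪q⁺ (inj₂ (x∈p∩q⁺ (∈E[]⁺ (∈U⁻ f₁∈U f₁∈T) (∈U⁻ f₂∈U f₂∈T) , f∈edges)))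
            where
            ∈U⁻ : ∀ {v} → v ∈ U → v ∈ T → v ∈ U⁻
            ∈U⁻ v∈U v∈T = x∈p∧x≢y⇒x∈p-y v∈U (∈T⇒≢b v∈T)
            f₁∈U = proj₁ (∈E[]⁻ {U} f∈E[U])
            f₂∈U = proj₂ (∈E[]⁻ {U} f∈E[U])
            f₁∈T = proj₁ (∈E[]⁻ {T} (edges⊆E[] f∈edges))
            f₂∈T = proj₂ (∈E[]⁻ {T} (edges⊆E[] f∈edges))

        tree : Tree T′
        tree = record
          { edges = edges′ ; root∈ = x∈p∪q⁺ (inj₂ root∈) ; ⊆C = ⊆C′ ; reach = reach′
          ; edges⊆E[] = edges′⊆E[T′] ; size = size′ ; acyclic = acyclic′ }

      grow : ∀ {T} → Acc _⊃_ T → Tree T → ∃ λ T′ → Tree T′ × Closed T′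
      grow {T} (acc rec) t with exit-or-closed T
      ... | inj₁ x      = grow (rec (Extend.T⊂T′ t x)) (Extend.tree t x)
      ... | inj₂ closed = T , t , closed

      closedTree : u ∈ C → ∃ λ T → Tree T × Closed T
      closedTree u∈C = grow (⊃-wellFounded _) (singleton u∈C)

    Certificate : (Fin (m G) → ℚ) → Set
    Certificate y =
        (∀ e → (0ℚ ≤ y e) × (y e ≤ 1ℚ))
      × (∀ e → 1ℚ ≤ χ C (end₁ G e) + χ C (end₂ G e))
      × (∀ (U : Subset (n G)) → Nonempty U → yInside G U y ≤ ℕ→ℚ ∣ U ∣ - 1ℚ)
      × (ySum G y ≡ xSum G (χ C) - 1ℚ)
      × (∀ e → (y e ≤ χ C (end₁ G e)) × (y e ≤ χ C (end₂ G e)))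

    spanningTree-certificate : ∀ {u} → IsVertexCover G C → (t : Tree u C) →
      Certificate (χ (Tree.edges t))
    spanningTree-certificate vc t =
      (λ _ → χ-bounds {p = edges}) , cover , subtour , total ,
      λ e → χ-mono (proj₁ ∘ ends {e}) , χ-mono (proj₂ ∘ ends {e})
      where
      open Tree t
      cover : ∀ e → 1ℚ ≤ χ C (end₁ G e) + χ C (end₂ G e)
      cover e = Equivalence.from (1≤χ+χ⇔ C _ _) (vc e)
      subtour : ∀ U → Nonempty U → yInside G U (χ edges) ≤ ℕ→ℚ ∣ U ∣ - 1ℚ
      subtour U ne = subst (_≤ _) (sym (yInside-χ U edges)) (ℕ→ℚ-≤-1 (acyclic U ne))
      total : ySum G (χ edges) ≡ xSum G (χ C) - 1ℚ
      total = begin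
        ySum G (χ edges)          ≡⟨ ∑-χ edges ⟩
        ℕ→ℚ ∣ edges ∣             ≡⟨ ℕ→ℚ-suc-1 ∣ edges ∣ ⟨
        ℕ→ℚ (suc ∣ edges ∣) - 1ℚ  ≡⟨ cong (λ k → ℕ→ℚ k - 1ℚ) size ⟨
        ℕ→ℚ ∣ C ∣ - 1ℚ            ≡⟨ cong (_- 1ℚ) (∑-χ C) ⟨
        xSum G (χ C) - 1ℚ         ∎
        where open ≡-Reasoning
      ends : ∀ {e} → e ∈ edges → end₁ G e ∈ C × end₂ G e ∈ C
      ends = ∈E[]⁻ ∘ edges⊆E[]

    connectedVertexCover⇒certificate : IsConnectedVertexCover G C → Σ (Fin (m G) → ℚ) Certificate
    connectedVertexCover⇒certificate (vc , (u , u∈C) , connected)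
      with T , t , closed ← closedTree u u∈C =
      χ (Tree.edges spanning) , spanningTree-certificate vc spanning
      where
      T≡C : T ≡ C
      T≡C = ⊆-antisym (Tree.⊆C t) λ v∈C →
        reach-closed closed (Tree.root∈ t) (connected u _ u∈C v∈C)
      spanning : Tree u C
      spanning = subst (Tree u) T≡C t

    -- By (iv) an edge of positive weight has both ends in C, so, T being closed,
    -- it lies in E[ T ] or in E[ C ─ T ].
    ySum≤yInside+yInside : ∀ {T y} → Closed T → (∀ e → 0ℚ ≤ y e) →
      (∀ e → (y e ≤ χ C (end₁ G e)) × (y e ≤ χ C (end₂ G e))) →
      ySum G y ≤ yInside G T y + yInside G (C ─ T) y
    ySum≤yInside+yInside {T} {y} closed 0≤y y≤χ = begin
      ySum G y
        ≤⟨ ∑-mono-≤ (m G) split ⟩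
      ∑ (m G) (λ e → restrict E[ T ] y e + restrict E[ C ─ T ] y e)
        ≡⟨ ∑-+ (m G) _ _ ⟩
      ∑ (m G) (restrict E[ T ] y) + ∑ (m G) (restrict E[ C ─ T ] y)
        ≡⟨ cong₂ _+_ (yInside≡∑restrict T y) (yInside≡∑restrict (C ─ T) y) ⟨
      yInside G T y + yInside G (C ─ T) y
        ∎
      where
      open ≤-Reasoning
      0≤restricts : ∀ e → 0ℚ ≤ restrict E[ T ] y e + restrict E[ C ─ T ] y e
      0≤restricts e =
        p≤q⇒p≤q+r (restrict-nonneg E[ T ] y (0≤y e)) (restrict-nonneg E[ C ─ T ] y (0≤y e))
      split : ∀ e → y e ≤ restrict E[ T ] y e + restrict E[ C ─ T ] y e
      split e with end₁ G e ∈? C | end₂ G e ∈? C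
      ... | no e₁∉C | _ = ≤-trans (proj₁ (y≤χ e)) (≤-trans (≤-reflexive (χ-∉ e₁∉C)) (0≤restricts e))
      ... | _ | no e₂∉C = ≤-trans (proj₂ (y≤χ e)) (≤-trans (≤-reflexive (χ-∉ e₂∉C)) (0≤restricts e))
      ... | yes e₁∈C | yes e₂∈C with end₁ G e ∈? T
      ...   | yes e₁∈T = p≤q⇒p≤q+r (≤-reflexive (sym (restrict-∈ E[ T ] y (∈E[]⁺ e₁∈T e₂∈T))))
                                (restrict-nonneg E[ C ─ T ] y (0≤y e))
        where
        e₂∈T : end₂ G e ∈ T
        e₂∈T = closed (e , inj₁ (refl , refl)) e₁∈T e₂∈C
      ...   | no  e₁∉T = p≤r⇒p≤q+r (restrict-nonneg E[ T ] y (0≤y e))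
                                (≤-reflexive (sym (restrict-∈ E[ C ─ T ] y (∈E[]⁺ e₁∈C─T e₂∈C─T))))
        where
        e₁∈C─T : end₁ G e ∈ C ─ T
        e₁∈C─T = x∈p∧x∉q⇒x∈p─q e₁∈C e₁∉T
        e₂∈C─T : end₂ G e ∈ C ─ T
        e₂∈C─T = x∈p∧x∉q⇒x∈p─q e₂∈C λ e₂∈T → e₁∉T (closed (e , inj₂ (refl , refl)) e₂∈T e₁∈C)

    module _ {y : Fin (m G) → ℚ} (0≤y : ∀ e → 0ℚ ≤ y e) (total : ySum G y ≡ xSum G (χ C) - 1ℚ) where
      private
        ySum≡∣C∣-1 : ySum G y ≡ ℕ→ℚ ∣ C ∣ - 1ℚ
        ySum≡∣C∣-1 = trans total (cong (_- 1ℚ) (∑-χ C))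

      nonempty : Nonempty C
      nonempty with nonempty? C
      ... | yes ne    = ne
      ... | no  empty = contradiction (≤-<-trans (∑-nonneg (m G) 0≤y) ySum<0) (<-irrefl refl)
        where
        ySum<0 : ySum G y < 0ℚ
        ySum<0 = subst (_< 0ℚ)
          (sym (trans ySum≡∣C∣-1 (cong (λ k → ℕ→ℚ k - 1ℚ) (Empty⇒∣p∣≡0 empty))))
          (p-1<p 0ℚ)

      C⊆closedTree : (∀ U → Nonempty U → yInside G U y ≤ ℕ→ℚ ∣ U ∣ - 1ℚ) →
        (∀ e → (y e ≤ χ C (end₁ G e)) × (y e ≤ χ C (end₂ G e))) →
        ∀ {u T} → Tree u T → Closed T → C ⊆ T
      C⊆closedTree subtour y≤χ {T = T} t closed {v} v∈C with v ∈? T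
      ... | yes v∈T = v∈T
      ... | no  v∉T = contradiction (≤-<-trans ySum≤ <∣C∣-1) (<-irrefl ySum≡∣C∣-1)
        where
        open Tree t
        ySum≤ : ySum G y ≤ (ℕ→ℚ ∣ T ∣ - 1ℚ) + (ℕ→ℚ ∣ C ─ T ∣ - 1ℚ)
        ySum≤ = ≤-trans (ySum≤yInside+yInside closed 0≤y y≤χ)
                        (+-mono-≤ (subtour T (_ , root∈))
                                  (subtour (C ─ T) (v , x∈p∧x∉q⇒x∈p─q v∈C v∉T)))
        <∣C∣-1 : (ℕ→ℚ ∣ T ∣ - 1ℚ) + (ℕ→ℚ ∣ C ─ T ∣ - 1ℚ) < ℕ→ℚ ∣ C ∣ - 1ℚ
        <∣C∣-1 = ℕ→ℚ-1-strictly-superadditive {∣ T ∣} (ℕ.≤-reflexive (p⊆q⇒∣p∣+∣q─p∣≡∣q∣ ⊆C))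

    certificate⇒connectedVertexCover : ∀ {y} → Certificate y → IsConnectedVertexCover G C
    certificate⇒connectedVertexCover (bounds , cover , subtour , total , y≤χ) =
      vc , nonempty (proj₁ ∘ bounds) total , connected
      where
      vc : IsVertexCover G C
      vc e = Equivalence.to (1≤χ+χ⇔ C _ _) (cover e)
      connected : ∀ u v → u ∈ C → v ∈ C → Reach G C u v
      connected u v u∈C v∈C with T , t , closed ← closedTree u u∈C =
        Tree.reach t (C⊆closedTree (proj₁ ∘ bounds) total subtour y≤χ t closed v∈C)

lemma1 : (G : Graph) → Connected G → (C : Subset (n G)) →
  IsConnectedVertexCover G C ⇔
    Σ (Fin (m G) → ℚ) (λ y →
      (∀ e → (0ℚ ≤ y e) × (y e ≤ 1ℚ))
      × (∀ e → 1ℚ ≤ χ C (end₁ G e) + χ C (end₂ G e))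
      × (∀ (U : Subset (n G)) → Nonempty U → yInside G U y ≤ ℕ→ℚ ∣ U ∣ - 1ℚ)
      × (ySum G y ≡ xSum G (χ C) - 1ℚ)
      × (∀ e → (y e ≤ χ C (end₁ G e)) × (y e ≤ χ C (end₂ G e))))
lemma1 G _ C =
  mk⇔ (connectedVertexCover⇒certificate G C) (certificate⇒connectedVertexCover G C ∘ proj₂)
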